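{- Let $A$ be a set of agents, let $x$ be an agent with $x \notin A$, and let $\phi$ be a fact. Suppose $PC(A,\phi)$ holds and all agents are honest (tell only the truth). Suppose further that for some agent $v_x \in A$ the following two communications take place: $v_x$ communicates to $x$ the fact $PC(A,\phi)$, and $v_x$ communicates to every member of $A$ the fact $K_x\,\phi$. Then $PC(A \cup \{x\},\phi)$ holds.
   Context: The setting is epistemic (temporal) logic over a collection of agents. For an agent $y$ and a predicate $\psi$, $K_y\,\psi$ means "agent $y$ knows $\psi$"; the standard laws of epistemic logic hold, in particular only truths can be known (if $K_y\,\psi$ then $\psi$). Public certifiability of a fact $\phi$ amongst a set $A$ of agents is defined by $PC(A,\phi) := \forall y,z \in A\,.\, K_y K_z\,\phi$. A communication "$v \to w : \psi$" means that agent $v$ tells agent (or every agent of the set) $w$ the fact $\psi$; since agents are honest, after such a communication the recipient knows $\psi$. -}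

module Defs where

open import Data.Product using (_×_; _,_)
open import Data.Sum using (_⊎_)
open import Relation.Binary.PropositionalEquality using (_≡_)
open import Relation.Binary.Structures using (IsEquivalence)

-- States are the (global) states of the system; for each agent a, R a s t
-- means agent a cannot distinguish state s from state t.  R a is an
-- equivalence relation, so all standard (S5) laws of epistemic logic hold,
-- in particular truthfulness (K_y ψ → ψ), positive and negative introspection,
-- and closure of knowledge under implication.
record EpistemicModel (Agent : Set) : Set₁ where
  field
    State : Set
    R     : Agent → State → State → Set
    R-equiv : (a : Agent) → IsEquivalence (R a)

module _ {Agent : Set} (M : EpistemicModel Agent) where
  open EpistemicModel M

  Fact : Set₁
  Fact = State → Set

  K : Agent → Fact → Fact
  K y ψ s = (t : State) → R y s t → ψ t

  PC : (Agent → Set) → Fact → Fact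
  PC A φ s = (y z : Agent) → A y → A z → K y (K z φ) s

  -- "v → W : ψ" (v tells every member of the set W the fact ψ), as observed
  -- at the state after the communication, with v honest: the communicated
  -- fact is true, and every recipient knows it.
  Communicates : Agent → (Agent → Set) → Fact → Fact
  Communicates v W ψ s = ψ s × ((w : Agent) → W w → K w ψ s)

_∪｛_｝ : {Agent : Set} → (Agent → Set) → Agent → (Agent → Set)
(A ∪｛ x ｝) y = A y ⊎ y ≡ x

｛_｝ : {Agent : Set} → Agent → (Agent → Set)
｛ x ｝ y = y ≡ x

-- Pairs inside A are covered by PC(A,φ); a pair (y, x) with y ∈ A is exactly
-- what the second communication delivers; for (x, z) with z ∈ A, x knows
-- PC(A,φ), which implies K_z φ by truthfulness; and (x, x) is positive
-- introspection applied to K_x φ, which the second communication made true.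
module Submission where

open import Defs
open import Data.Product using (_,_)
open import Data.Sum using (inj₁; inj₂)
open import Relation.Binary.PropositionalEquality using (refl)
open import Relation.Binary.Structures using (IsEquivalence)
open import Relation.Nullary using (¬_)

module _ {Agent : Set} (M : EpistemicModel Agent) where
  open EpistemicModel M

  K-truth : ∀ {a ψ s} → K M a ψ s → ψ s
  K-truth {a} k = k _ (IsEquivalence.refl (R-equiv a))

  K-introspection : ∀ {a ψ s} → K M a ψ s → K M a (K M a ψ) s
  K-introspection {a} k t s~t u t~u = k u (IsEquivalence.trans (R-equiv a) s~t t~u)

  K-mono : ∀ {a} {ψ χ : Fact M} {s} → (∀ {t} → ψ t → χ t) → K M a ψ s → K M a χ s
  K-mono ψ⇒χ k t s~t = ψ⇒χ (k t s~t)

  PC⇒K : ∀ {A φ s z} → A z → PC M A φ s → K M z φ s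
  PC⇒K {z = z} Az pc = K-truth (pc z z Az Az)

lemma1 : {Agent : Set} (M : EpistemicModel Agent) (s : EpistemicModel.State M)
    (A : Agent → Set) (x : Agent) (φ : Fact M) →
    ¬ A x →
    PC M A φ s →
    (vx : Agent) → A vx →
    Communicates M vx ｛ x ｝ (PC M A φ) s →
    Communicates M vx A (K M x φ) s →
    PC M (A ∪｛ x ｝) φ s
lemma1 M s A x φ _ pc vx _ (_ , x-knows-PC) (Kxφ , A-knows-Kxφ) = pc′
  where
  pc′ : PC M (A ∪｛ x ｝) φ s
  pc′ y z (inj₁ Ay) (inj₁ Az) = pc y z Ay Az
  pc′ y .x (inj₁ Ay) (inj₂ refl) = A-knows-Kxφ y Ay
  pc′ .x z (inj₂ refl) (inj₁ Az) = K-mono M (PC⇒K M Az) (x-knows-PC x refl)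
  pc′ .x .x (inj₂ refl) (inj₂ refl) = K-introspection M Kxφ
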